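{- Let $G$ be a graph with $n\ge 2$ vertices equipped with nonnegative real edge weights ${\bf w}$. Then $$\Lambda(G,{\bf w})\ge D_2(G,{\bf w})\ge\max[D(G,{\bf w}),\,\Delta_{n-1}(G,{\bf w})].$$
   Context: Graphs are finite, undirected and loopless; multiple edges allowed. For a subgraph $H$ of $G$, $d_H(x,{\bf w})=\sum_{e\in E(H),\,e\ni x}w_e$. For $k\ge1$, $\delta_k(H,{\bf w})=\max_{x_1,\ldots,x_{k-1}\in V(H)}\min_{x\in V(H)\setminus\{x_1,\ldots,x_{k-1}\}}d_H(x,{\bf w})$ (the $k$th smallest weighted degree), $\delta(H,{\bf w})=\delta_1(H,{\bf w})$, and $\Delta_k(G,{\bf w})=\min_{x_1,\ldots,x_{k-1}\in V(G)}\max_{x\in V(G)\setminus\{x_1,\ldots,x_{k-1}\}}d_G(x,{\bf w})$ (the $k$th largest weighted degree). The weighted degeneracy numbers are $D(G,{\bf w})=\max_{H\subseteq G}\delta(H,{\bf w}|_H)$ and $D_2(G,{\bf w})=\max_{H\subseteq G}\delta_2(H,{\bf w}|_H)$, maxima over all subgraphs $H$ of $G$. For distinct $x,y$, $\lambda_G(x,y;{\bf w})$ is the maximum flow from $x$ to $y$ with edge capacities $w_e$ (equivalently the minimum total weight of a set of edges of the form $E(X,V(G)\setminus X)$ with $x\in X$, $y\notin X$), and $\Lambda(G,{\bf w})=\max_{x\neq y}\lambda_G(x,y;{\bf w})$. -}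

module Defs where

open import Level using (0ℓ)
open import Data.Nat as ℕ using (ℕ; _∸_)
open import Data.Fin using (Fin; zero; suc; _≟_)
open import Data.Bool using (Bool; true; false; if_then_else_; _∨_; _∧_; _xor_)
open import Data.Unit using (⊤)
open import Data.Product using (Σ; ∃; _×_; _,_)
open import Relation.Nullary using (¬_; ⌊_⌋)
open import Relation.Binary.PropositionalEquality using (_≡_; _≢_)
open import Relation.Binary.Structures using (IsTotalOrder)
open import Algebra.Structures using (IsCommutativeRing)

-- An axiomatic model of the real numbers: a complete ordered field.
-- (agda-stdlib has no reals; the theorem is stated for every such model.)

record RealField : Set₁ where
  infixl 6 _+_
  infixl 7 _*_
  infix  4 _≤_
  field
    ℝ   : Set
    _+_ : ℝ → ℝ → ℝ
    _*_ : ℝ → ℝ → ℝ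
    -_  : ℝ → ℝ
    0ℝ  : ℝ
    1ℝ  : ℝ
    _≤_ : ℝ → ℝ → Set
    isCommutativeRing : IsCommutativeRing _≡_ _+_ _*_ -_ 0ℝ 1ℝ
    0≢1       : 0ℝ ≢ 1ℝ
    inverse   : ∀ x → x ≢ 0ℝ → Σ ℝ (λ y → x * y ≡ 1ℝ)
    isTotalOrder : IsTotalOrder _≡_ _≤_
    +-mono-≤  : ∀ {x y} z → x ≤ y → x + z ≤ y + z
    *-nonneg  : ∀ {x y} → 0ℝ ≤ x → 0ℝ ≤ y → 0ℝ ≤ x * y
    complete  : (P : ℝ → Set) → Σ ℝ P → Σ ℝ (λ b → ∀ x → P x → x ≤ b) →
                Σ ℝ (λ s → (∀ x → P x → x ≤ s) ×
                           (∀ b → (∀ x → P x → x ≤ b) → s ≤ b))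

-- Finite loopless multigraphs on vertex set Fin n with m edges.
-- Edge e joins tail e and head e (tail e ≢ head e); parallel edges allowed.

record Graph (n : ℕ) : Set where
  field
    m    : ℕ
    tail : Fin m → Fin n
    head : Fin m → Fin n
    loopless : ∀ e → tail e ≢ head e

module Weighted (R : RealField) where
  open RealField R

  ΣFin : ∀ {k} → (Fin k → ℝ) → ℝ
  ΣFin {ℕ.zero}  f = 0ℝ
  ΣFin {ℕ.suc k} f = f zero + ΣFin (λ i → f (suc i))

  -- v is the maximum / minimum of the (functional) relation Val over the
  -- index set P (values exist only for indices where Val has one).
  IsMaxOf : {I : Set} → (I → Set) → (I → ℝ → Set) → ℝ → Set
  IsMaxOf {I} P Val v = Σ I (λ i → P i × Val i v) ×
                        (∀ i u → P i → Val i u → u ≤ v)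

  IsMinOf : {I : Set} → (I → Set) → (I → ℝ → Set) → ℝ → Set
  IsMinOf {I} P Val v = Σ I (λ i → P i × Val i v) ×
                        (∀ i u → P i → Val i u → v ≤ u)

  module _ {n : ℕ} (G : Graph n) where
    open Graph G

    Weights : Set
    Weights = Fin m → ℝ

    NonNeg : Weights → Set
    NonNeg w = ∀ e → 0ℝ ≤ w e

    record Subgraph : Set where
      constructor sub
      field
        V : Fin n → Bool
        E : Fin m → Bool
        closed : ∀ e → E e ≡ true → (V (tail e) ≡ true) × (V (head e) ≡ true)
    open Subgraph public

    incident : Fin n → Fin m → Bool
    incident x e = ⌊ x ≟ tail e ⌋ ∨ ⌊ x ≟ head e ⌋

    degH : Weights → Subgraph → Fin n → ℝ
    degH w H x = ΣFin (λ e → if E H e ∧ incident x e then w e else 0ℝ)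

    degG : Weights → Fin n → ℝ
    degG w x = ΣFin (λ e → if incident x e then w e else 0ℝ)

    IsDelta : Weights → Subgraph → ℝ → Set
    IsDelta w H = IsMinOf (λ x → V H x ≡ true) (λ x u → degH w H x ≡ u)

    IsDelta2 : Weights → Subgraph → ℝ → Set
    IsDelta2 w H = IsMaxOf (λ x₁ → V H x₁ ≡ true)
      (λ x₁ → IsMinOf (λ x → (V H x ≡ true) × (x ≢ x₁)) (λ x u → degH w H x ≡ u))

    IsD : Weights → ℝ → Set
    IsD w = IsMaxOf (λ _ → ⊤) (IsDelta w)

    IsD2 : Weights → ℝ → Set
    IsD2 w = IsMaxOf (λ _ → ⊤) (IsDelta2 w)

    IsDeltaMaxNm1 : Weights → ℝ → Set
    IsDeltaMaxNm1 w = IsMinOf {Fin (n ∸ 2) → Fin n} (λ _ → ⊤)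
      (λ xs → IsMaxOf (λ x → ∀ j → xs j ≢ x) (λ x u → degG w x ≡ u))

    cutWeight : Weights → (Fin n → Bool) → ℝ
    cutWeight w X = ΣFin (λ e → if X (tail e) xor X (head e) then w e else 0ℝ)

    IsLocalConn : Weights → Fin n → Fin n → ℝ → Set
    IsLocalConn w x y = IsMinOf (λ X → (X x ≡ true) × (X y ≡ false))
                                (λ X u → cutWeight w X ≡ u)

    IsΛ : Weights → ℝ → Set
    IsΛ w = IsMaxOf {Fin n × Fin n} (λ { (x , y) → x ≢ y })
                    (λ { (x , y) → IsLocalConn w x y })

-- D ≤ D₂: a subgraph H attaining D either has a second vertex, and then
-- δ(H) ≤ δ₂(H), or it is a single isolated vertex, of degree 0 ≤ δ₂(G).
-- Δₙ₋₁ ≤ D₂: if a and b have the smallest and second smallest degree in G,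
-- deleting every other vertex shows Δₙ₋₁ ≤ d(b) = min_{x ≠ a} d(x) ≤ δ₂(G).
-- D₂ ≤ Λ is Mader's pendant-pair argument. Given H and x₁ attaining δ₂(H),
-- order V(H) by maximum adjacency starting from x₁. If s and t are the last
-- two vertices, every s–t cut weighs at least the weight joining t to the
-- rest of V(H), which is d_H(t) ≥ δ₂(H) because t ≠ x₁.

module Submission where

open import Defs
open import Level using (0ℓ)
open import Data.Nat as ℕ using (ℕ)
import Data.Nat.Properties as NP
open import Data.Fin using (Fin; zero; suc; _≟_; punchIn; punchOut)
open import Data.Fin.Properties using (any?; punchIn-punchOut; punchInᵢ≢i; punchIn-injective; punchOut-injective)
open import Data.Bool using (Bool; true; false; if_then_else_; _∨_; _∧_; _xor_)
import Data.Bool.Properties as Boolₚ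
open import Data.Product using (Σ; ∃; _×_; _,_; proj₁; proj₂)
open import Data.Sum using (_⊎_; inj₁; inj₂; [_,_])
open import Data.List using (List; []; _∷_; map; _++_; filter)
open import Data.List.Relation.Unary.Any using (here)
open import Data.List.Membership.Propositional using (_∈_)
open import Data.List.Membership.Propositional.Properties
  using (∈-++⁺ˡ; ∈-++⁺ʳ; ∈-map⁺; ∈-filter⁺; ∈-filter⁻; ∈-allFin)
open import Data.List.Relation.Unary.All as All using ()
open import Data.Vec using (Vec; []; _∷_; tabulate; lookup)
open import Data.Vec.Properties using (lookup∘tabulate; lookup⇒[]=; []=⇒lookup)
import Data.Fin.Subset as Sub
open import Data.Fin.Subset.Properties using (p⊂q⇒∣p∣<∣q∣; ∣⊤∣≡n; ∈⊤)
open import Relation.Nullary using (¬_; Dec; does; yes; no)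
open import Relation.Nullary.Decidable using (dec-true; dec-false; _×-dec_; ¬?)
open import Relation.Unary using (Pred; Decidable)
open import Relation.Binary.Bundles using (TotalOrder)
import Relation.Binary.Construct.Flip.EqAndOrd as Flip
open import Relation.Binary.PropositionalEquality using (_≡_; _≢_; refl; sym; trans; cong; cong₂; subst)
open import Relation.Binary.Structures using (IsTotalOrder)
open import Algebra.Structures using (IsCommutativeRing)
open import Algebra.Bundles using (CommutativeSemigroup)
open import Data.Empty using (⊥; ⊥-elim)
open import Data.Unit using (⊤; tt)
open import Function using (_∘_; id)

module Extremum {b ℓ₁ ℓ₂} (O : TotalOrder b ℓ₁ ℓ₂) where
  open TotalOrder O renaming (Carrier to B; _≤_ to _≼_)
  open import Data.List.Extrema O using (argmin; argmin-all; f[argmin]≤f[xs])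

  minimiser : ∀ {a p} {I : Set a} {xs : List I} → (∀ i → i ∈ xs) →
              {P : Pred I p} → Decidable P → (f : I → B) → ∀ {i₀} → P i₀ →
              Σ I λ i → P i × (∀ j → P j → f i ≼ f j)
  minimiser {xs = xs} enum P? f {i₀} Pi₀ =
    argmin f i₀ ys ,
    argmin-all f Pi₀ (All.tabulate λ i∈ys → proj₂ (∈-filter⁻ P? {xs = xs} i∈ys)) ,
    λ j Pj → All.lookup (f[argmin]≤f[xs] i₀ ys) (∈-filter⁺ P? (enum j) Pj)
    where ys = filter P? xs

allBoolVecs : ∀ n → List (Vec Bool n)
allBoolVecs ℕ.zero    = [] ∷ []
allBoolVecs (ℕ.suc n) = map (true ∷_) (allBoolVecs n) ++ map (false ∷_) (allBoolVecs n)

∈-allBoolVecs : ∀ {n} (v : Vec Bool n) → v ∈ allBoolVecs n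
∈-allBoolVecs []          = here refl
∈-allBoolVecs (true ∷ v)  = ∈-++⁺ˡ (∈-map⁺ (true ∷_) (∈-allBoolVecs v))
∈-allBoolVecs (false ∷ v) = ∈-++⁺ʳ _ (∈-map⁺ (false ∷_) (∈-allBoolVecs v))

another : ∀ {k} (a : Fin (ℕ.suc (ℕ.suc k))) → ∃ λ x → x ≢ a
another zero    = suc zero , λ ()
another (suc _) = zero , λ ()

exceptTwo : ∀ {k} {a b : Fin (ℕ.suc (ℕ.suc k))} → a ≢ b → Fin k → Fin (ℕ.suc (ℕ.suc k))
exceptTwo {a = a} a≢b j = punchIn a (punchIn (punchOut a≢b) j)

module _ {k} {a b : Fin (ℕ.suc (ℕ.suc k))} (a≢b : a ≢ b) where

  exceptTwo≢b : ∀ j → exceptTwo a≢b j ≢ b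
  exceptTwo≢b j eq = punchInᵢ≢i (punchOut a≢b) j
    (punchIn-injective a _ _ (trans eq (sym (punchIn-punchOut a≢b))))

  exceptTwo-misses : ∀ x → (∀ j → exceptTwo a≢b j ≢ x) → x ≡ a ⊎ x ≡ b
  exceptTwo-misses x missed with x ≟ a | x ≟ b
  ... | yes x≡a | _       = inj₁ x≡a
  ... | no _    | yes x≡b = inj₂ x≡b
  ... | no x≢a  | no x≢b  = ⊥-elim (missed (punchOut b′≢x′) hit)
    where
      a≢x : a ≢ x
      a≢x = x≢a ∘ sym
      b′≢x′ : punchOut a≢b ≢ punchOut a≢x
      b′≢x′ eq = x≢b (sym (punchOut-injective a≢b a≢x eq))
      hit : exceptTwo a≢b (punchOut b′≢x′) ≡ x
      hit = trans (cong (punchIn a) (punchIn-punchOut b′≢x′)) (punchIn-punchOut a≢x)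

infixl 6 _∪_

_∪_ : ∀ {n} → (Fin n → Bool) → (Fin n → Bool) → Fin n → Bool
(A ∪ B) x = A x ∨ B x

infix 4 _⊆_

_⊆_ : ∀ {n} → (Fin n → Bool) → (Fin n → Bool) → Set
A ⊆ B = ∀ x → A x ≡ true → B x ≡ true

Disjoint : ∀ {n} → (Fin n → Bool) → (Fin n → Bool) → Set
Disjoint A B = ∀ x → A x ≡ true → B x ≡ true → ⊥

⁅_⁆ : ∀ {n} → Fin n → Fin n → Bool
⁅ v ⁆ x = does (x ≟ v)

⁅⁆-refl : ∀ {n} (v : Fin n) → ⁅ v ⁆ v ≡ true
⁅⁆-refl v = dec-true (v ≟ v) refl

⁅⁆-true⁻ : ∀ {n} {v x : Fin n} → ⁅ v ⁆ x ≡ true → x ≡ v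
⁅⁆-true⁻ {v = v} {x} h with x ≟ v
... | yes x≡v = x≡v

⁅⁆-false : ∀ {n} {v x : Fin n} → x ≢ v → ⁅ v ⁆ x ≡ false
⁅⁆-false {v = v} {x} = dec-false (x ≟ v)

∧-true⁺ : ∀ {x y} → x ≡ true → y ≡ true → x ∧ y ≡ true
∧-true⁺ refl refl = refl

∧-true⁻ : ∀ {x y} → x ∧ y ≡ true → x ≡ true × y ≡ true
∧-true⁻ {true} {true} _ = refl , refl

∨-trueˡ : ∀ {x} y → x ≡ true → x ∨ y ≡ true
∨-trueˡ _ refl = refl

∨-trueʳ : ∀ x {y} → y ≡ true → x ∨ y ≡ true
∨-trueʳ true  _    = refl
∨-trueʳ false refl = refl

∨-true⁻ : ∀ {x y} → x ∨ y ≡ true → x ≡ true ⊎ y ≡ true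
∨-true⁻ {true}  _ = inj₁ refl
∨-true⁻ {false} h = inj₂ h

∨-false⁺ : ∀ {x y} → x ≡ false → y ≡ false → x ∨ y ≡ false
∨-false⁺ refl refl = refl

∨-false⁻ : ∀ {x y} → x ∨ y ≡ false → x ≡ false × y ≡ false
∨-false⁻ {false} {false} _ = refl , refl

xor-true⁺ : ∀ {x y} → x ≢ y → x xor y ≡ true
xor-true⁺ {true}  {true}  x≢y = ⊥-elim (x≢y refl)
xor-true⁺ {true}  {false} _   = refl
xor-true⁺ {false} {true}  _   = refl
xor-true⁺ {false} {false} x≢y = ⊥-elim (x≢y refl)

∪-⊆ˡ : ∀ {n} (A B : Fin n → Bool) → A ⊆ A ∪ B
∪-⊆ˡ A B x = ∨-trueˡ (B x)

∪-⊆ʳ : ∀ {n} (A B : Fin n → Bool) → B ⊆ A ∪ B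
∪-⊆ʳ A B x = ∨-trueʳ (A x)

∪-least : ∀ {n} {A B C : Fin n → Bool} → A ⊆ C → B ⊆ C → A ∪ B ⊆ C
∪-least A⊆C B⊆C x = [ A⊆C x , B⊆C x ] ∘ ∨-true⁻

membership-≢ : ∀ {a} {I : Set a} (A : I → Bool) {x y} → A x ≡ true → A y ≡ false → x ≢ y
membership-≢ _ Ax Ay refl with () ← trans (sym Ax) Ay

members : ∀ {n} → (Fin n → Bool) → Sub.Subset n
members = tabulate

∈-members⁺ : ∀ {n} {A : Fin n → Bool} {x} → A x ≡ true → x Sub.∈ members A
∈-members⁺ {A = A} {x} Ax = lookup⇒[]= x (members A) (trans (lookup∘tabulate A x) Ax)

∈-members⁻ : ∀ {n} {A : Fin n → Bool} {x} → x Sub.∈ members A → A x ≡ true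
∈-members⁻ {A = A} {x} x∈A = trans (sym (lookup∘tabulate A x)) ([]=⇒lookup x∈A)

module _ {n} (A : Fin n → Bool) where

  members-⊂ : ∀ {v} → A v ≡ false → members A Sub.⊂ members (A ∪ ⁅ v ⁆)
  members-⊂ {v} Av =
    (λ x∈A → ∈-members⁺ (∨-trueˡ _ (∈-members⁻ x∈A))) ,
    v , ∈-members⁺ (∨-trueʳ (A v) (⁅⁆-refl v)) , λ v∈A → membership-≢ A (∈-members⁻ v∈A) Av refl

  ∣members∣<n : ∀ {u} → A u ≡ false → Sub.∣ members A ∣ ℕ.< n
  ∣members∣<n {u} Au = subst (Sub.∣ members A ∣ ℕ.<_) (∣⊤∣≡n n)
    (p⊂q⇒∣p∣<∣q∣ ((λ _ → ∈⊤) , u , ∈⊤ , λ u∈A → membership-≢ A (∈-members⁻ u∈A) Au refl))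

-- Weighted sums over a complete ordered field

module Reals (R : RealField) where
  open RealField R
  open Weighted R
  open IsCommutativeRing isCommutativeRing
    using (+-comm; +-identityˡ; +-identityʳ; +-isCommutativeSemigroup)
  open IsTotalOrder isTotalOrder using (antisym; reflexive) renaming (refl to ≤-refl; trans to ≤-trans)

  ≤-totalOrder : TotalOrder 0ℓ 0ℓ 0ℓ
  ≤-totalOrder = record { isTotalOrder = isTotalOrder }

  open import Relation.Binary.Reasoning.PartialOrder (TotalOrder.poset ≤-totalOrder)

  +-commutativeSemigroup : CommutativeSemigroup 0ℓ 0ℓ
  +-commutativeSemigroup = record { isCommutativeSemigroup = +-isCommutativeSemigroup }

  open import Algebra.Properties.CommutativeSemigroup +-commutativeSemigroup using (interchange)

  +-mono-≤₂ : ∀ {a b c d} → a ≤ b → c ≤ d → a + c ≤ b + d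
  +-mono-≤₂ {a} {b} {c} {d} a≤b c≤d = begin
    a + c ≤⟨ +-mono-≤ c a≤b ⟩
    b + c ≡⟨ +-comm b c ⟩
    c + b ≤⟨ +-mono-≤ b c≤d ⟩
    d + b ≡⟨ +-comm d b ⟩
    b + d ∎

  x≤x+y : ∀ {x y} → 0ℝ ≤ y → x ≤ x + y
  x≤x+y {x} {y} 0≤y = begin
    x      ≡⟨ +-identityʳ x ⟨
    x + 0ℝ ≤⟨ +-mono-≤₂ ≤-refl 0≤y ⟩
    x + y  ∎

  x≤y+x : ∀ {x y} → 0ℝ ≤ y → x ≤ y + x
  x≤y+x {x} {y} 0≤y = ≤-trans (x≤x+y 0≤y) (reflexive (+-comm x y))

  +-nonneg : ∀ {x y} → 0ℝ ≤ x → 0ℝ ≤ y → 0ℝ ≤ x + y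
  +-nonneg 0≤x 0≤y = ≤-trans 0≤x (x≤x+y 0≤y)

  ΣFin-mono : ∀ {k} {f g : Fin k → ℝ} → (∀ i → f i ≤ g i) → ΣFin f ≤ ΣFin g
  ΣFin-mono {ℕ.zero}  f≤g = ≤-refl
  ΣFin-mono {ℕ.suc k} f≤g = +-mono-≤₂ (f≤g zero) (ΣFin-mono (f≤g ∘ suc))

  ΣFin-cong : ∀ {k} {f g : Fin k → ℝ} → (∀ i → f i ≡ g i) → ΣFin f ≡ ΣFin g
  ΣFin-cong {ℕ.zero}  f≗g = refl
  ΣFin-cong {ℕ.suc k} f≗g = cong₂ _+_ (f≗g zero) (ΣFin-cong (f≗g ∘ suc))

  ΣFin-+ : ∀ {k} (f g : Fin k → ℝ) → ΣFin (λ i → f i + g i) ≡ ΣFin f + ΣFin g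
  ΣFin-+ {ℕ.zero}  f g = sym (+-identityˡ 0ℝ)
  ΣFin-+ {ℕ.suc k} f g = trans (cong (f zero + g zero +_) (ΣFin-+ (f ∘ suc) (g ∘ suc)))
                               (interchange (f zero) (g zero) _ _)

  ΣFin-0 : ∀ {k} → ΣFin {k} (λ _ → 0ℝ) ≡ 0ℝ
  ΣFin-0 {ℕ.zero}  = refl
  ΣFin-0 {ℕ.suc k} = trans (cong (0ℝ +_) (ΣFin-0 {k})) (+-identityˡ 0ℝ)

  ΣFin-nonneg : ∀ {k} {f : Fin k → ℝ} → (∀ i → 0ℝ ≤ f i) → 0ℝ ≤ ΣFin f
  ΣFin-nonneg {k} 0≤f = ≤-trans (reflexive (sym (ΣFin-0 {k}))) (ΣFin-mono 0≤f)

  masked : ∀ {k} → (Fin k → Bool) → (Fin k → ℝ) → Fin k → ℝ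
  masked φ f i = if φ i then f i else 0ℝ

  sumOver : ∀ {k} → (Fin k → Bool) → (Fin k → ℝ) → ℝ
  sumOver φ f = ΣFin (masked φ f)

  module _ {x : ℝ} (0≤x : 0ℝ ≤ x) where

    if-nonneg : ∀ b → 0ℝ ≤ (if b then x else 0ℝ)
    if-nonneg true  = 0≤x
    if-nonneg false = ≤-refl

    if-mono : ∀ b c → (b ≡ true → c ≡ true) → (if b then x else 0ℝ) ≤ (if c then x else 0ℝ)
    if-mono true  c b⇒c rewrite b⇒c refl = ≤-refl
    if-mono false c b⇒c = if-nonneg c

    if-subadditive : ∀ b c d → (b ≡ true → c ∨ d ≡ true) →
      (if b then x else 0ℝ) ≤ (if c then x else 0ℝ) + (if d then x else 0ℝ)
    if-subadditive false c     d     _   = +-nonneg (if-nonneg c) (if-nonneg d)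
    if-subadditive true  true  d     _   = x≤x+y (if-nonneg d)
    if-subadditive true  false true  _   = x≤y+x ≤-refl
    if-subadditive true  false false b⇒c∨d with () ← b⇒c∨d refl

    if-superadditive : ∀ b c d → (b ≡ true → c ≡ true → ⊥) →
                       (b ≡ true → d ≡ true) → (c ≡ true → d ≡ true) →
      (if b then x else 0ℝ) + (if c then x else 0ℝ) ≤ (if d then x else 0ℝ)
    if-superadditive true  true  d     disj _   _   = ⊥-elim (disj refl refl)
    if-superadditive true  false d     _    b⇒d _   rewrite b⇒d refl = reflexive (+-identityʳ x)
    if-superadditive false true  d     _    _   c⇒d rewrite c⇒d refl = reflexive (+-identityˡ x)
    if-superadditive false false d     _    _   _   = ≤-trans (reflexive (+-identityˡ 0ℝ)) (if-nonneg d)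

  module _ {k} {f : Fin k → ℝ} (0≤f : ∀ i → 0ℝ ≤ f i) where

    sumOver-nonneg : ∀ φ → 0ℝ ≤ sumOver φ f
    sumOver-nonneg φ = ΣFin-nonneg (λ i → if-nonneg (0≤f i) (φ i))

    sumOver-mono : ∀ {φ ψ} → φ ⊆ ψ → sumOver φ f ≤ sumOver ψ f
    sumOver-mono {φ} {ψ} φ⊆ψ = ΣFin-mono (λ i → if-mono (0≤f i) (φ i) (ψ i) (φ⊆ψ i))

    sumOver-subadditive : ∀ {φ ψ χ} → φ ⊆ ψ ∪ χ → sumOver φ f ≤ sumOver ψ f + sumOver χ f
    sumOver-subadditive {φ} {ψ} {χ} φ⊆ψ∪χ = begin
      sumOver φ f
        ≤⟨ ΣFin-mono (λ i → if-subadditive (0≤f i) (φ i) (ψ i) (χ i) (φ⊆ψ∪χ i)) ⟩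
      ΣFin (λ i → masked ψ f i + masked χ f i)
        ≡⟨ ΣFin-+ (masked ψ f) (masked χ f) ⟩
      sumOver ψ f + sumOver χ f ∎

    sumOver-superadditive : ∀ {φ ψ χ} → Disjoint ψ χ → ψ ⊆ φ → χ ⊆ φ →
                            sumOver ψ f + sumOver χ f ≤ sumOver φ f
    sumOver-superadditive {φ} {ψ} {χ} disj ψ⊆φ χ⊆φ = begin
      sumOver ψ f + sumOver χ f
        ≡⟨ ΣFin-+ (masked ψ f) (masked χ f) ⟨
      ΣFin (λ i → masked ψ f i + masked χ f i)
        ≤⟨ ΣFin-mono (λ i → if-superadditive (0≤f i) (ψ i) (χ i) (φ i) (disj i) (ψ⊆φ i) (χ⊆φ i)) ⟩
      sumOver φ f ∎

  module _ {I : Set} {xs : List I} (enum : ∀ i → i ∈ xs)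
           {P : I → Set} (P? : Decidable P) (f : I → ℝ) {i₀ : I} (Pi₀ : P i₀) where

    IsMinOf-exists : Σ ℝ (IsMinOf P (λ i u → f i ≡ u))
    IsMinOf-exists with Extremum.minimiser ≤-totalOrder enum P? f Pi₀
    ... | i , Pi , min = f i , (i , Pi , refl) , λ j u Pj fj≡u → subst (f i ≤_) fj≡u (min j Pj)

    IsMaxOf-exists : Σ ℝ (IsMaxOf P (λ i u → f i ≡ u))
    IsMaxOf-exists with Extremum.minimiser (Flip.totalOrder ≤-totalOrder) enum P? f Pi₀
    ... | i , Pi , max = f i , (i , Pi , refl) , λ j u Pj fj≡u → subst (_≤ f i) fj≡u (max j Pj)

  module _ {I : Set} {Val : I → ℝ → Set} where

    IsMinOf-unique : ∀ {P u v} → IsMinOf P Val u → IsMinOf P Val v → u ≡ v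
    IsMinOf-unique ((i , Pi , Val-i-u) , u-min) ((j , Pj , Val-j-v) , v-min) =
      antisym (u-min j _ Pj Val-j-v) (v-min i _ Pi Val-i-u)

    IsMinOf-antitone : ∀ {P Q} → (∀ i → P i → Q i) → ∀ {u v} → IsMinOf Q Val v → IsMinOf P Val u → v ≤ u
    IsMinOf-antitone P⊆Q (_ , v-min) ((i , Pi , Val-i-u) , _) = v-min i _ (P⊆Q i Pi) Val-i-u

  TwoSmallest : ∀ {k} → (Fin (ℕ.suc (ℕ.suc k)) → ℝ) → Set
  TwoSmallest f = Σ (Fin _) λ a → Σ (Fin _) λ b → b ≢ a × f a ≤ f b × (∀ x → x ≢ a → f b ≤ f x)

  twoSmallest : ∀ {k} (f : Fin (ℕ.suc (ℕ.suc k)) → ℝ) → TwoSmallest f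
  twoSmallest f = withSmallest (Extremum.minimiser ≤-totalOrder ∈-allFin (λ _ → yes tt) f {zero} tt)
    where
      withSmallest : Σ (Fin _) (λ a → ⊤ × (∀ x → ⊤ → f a ≤ f x)) → TwoSmallest f
      withSmallest (a , _ , a-min) =
        let b , b≢a , b-min = Extremum.minimiser ≤-totalOrder ∈-allFin (λ x → ¬? (x ≟ a)) f (proj₂ (another a))
        in a , b , b≢a , a-min b tt , b-min

  -- Edges, adjacency and cuts

  module Network {n} (G : Graph n) (w : Weights G) (0≤w : NonNeg G w) where
    open Graph G

    weight : (Fin m → Bool) → ℝ
    weight φ = sumOver φ w

    Links : Fin m → Fin n → Fin n → Set
    Links e x y = (tail e ≡ x × head e ≡ y) ⊎ (tail e ≡ y × head e ≡ x)

    joins : Fin n → (Fin n → Bool) → Fin m → Bool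
    joins x A e = (⁅ x ⁆ (tail e) ∧ A (head e)) ∨ (⁅ x ⁆ (head e) ∧ A (tail e))

    inside : (Fin n → Bool) → Fin m → Bool
    inside B e = B (tail e) ∧ B (head e)

    crosses : (Fin n → Bool) → Fin m → Bool
    crosses X e = X (tail e) xor X (head e)

    module _ {e : Fin m} {x y : Fin n} where

      Links-distinct : Links e x y → x ≢ y
      Links-distinct (inj₁ (refl , refl)) = loopless e
      Links-distinct (inj₂ (refl , refl)) = loopless e ∘ sym

      joins⁺ : ∀ A → Links e x y → A y ≡ true → joins x A e ≡ true
      joins⁺ _ (inj₁ (refl , refl)) Ay = ∨-trueˡ _ (∧-true⁺ (⁅⁆-refl x) Ay)
      joins⁺ _ (inj₂ (refl , refl)) Ay = ∨-trueʳ _ (∧-true⁺ (⁅⁆-refl x) Ay)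

      endpoints-in : ∀ B → Links e x y → inside B e ≡ true → B x ≡ true × B y ≡ true
      endpoints-in _ (inj₁ (refl , refl)) = ∧-true⁻
      endpoints-in _ (inj₂ (refl , refl)) h = let Bt , Bh = ∧-true⁻ h in Bh , Bt

      inside⁺ : ∀ B → Links e x y → B x ≡ true → B y ≡ true → inside B e ≡ true
      inside⁺ _ (inj₁ (refl , refl)) Bx By = ∧-true⁺ Bx By
      inside⁺ _ (inj₂ (refl , refl)) Bx By = ∧-true⁺ By Bx

      crosses⁺ : ∀ X → Links e x y → X x ≢ X y → crosses X e ≡ true
      crosses⁺ _ (inj₁ (refl , refl)) Xx≢Xy = xor-true⁺ Xx≢Xy
      crosses⁺ _ (inj₂ (refl , refl)) Xx≢Xy = xor-true⁺ (Xx≢Xy ∘ sym)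

    joins⁻ : ∀ {e x} A → joins x A e ≡ true → ∃ λ y → Links e x y × A y ≡ true
    joins⁻ {e} {x} A h with ∨-true⁻ {⁅ x ⁆ (tail e) ∧ A (head e)} h
    ... | inj₁ h₁ = let t∈⁅x⁆ , Ah = ∧-true⁻ h₁ in head e , inj₁ (⁅⁆-true⁻ t∈⁅x⁆ , refl) , Ah
    ... | inj₂ h₂ = let h∈⁅x⁆ , At = ∧-true⁻ h₂ in tail e , inj₂ (refl , ⁅⁆-true⁻ h∈⁅x⁆) , At

    joins⁅⁆⁻ : ∀ {e x} y → joins x ⁅ y ⁆ e ≡ true → Links e x y
    joins⁅⁆⁻ {e} {x} y h with joins⁻ ⁅ y ⁆ h
    ... | _ , link , y′∈⁅y⁆ = subst (Links e x) (⁅⁆-true⁻ y′∈⁅y⁆) link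

    incident⁻ : ∀ {e x} → incident G x e ≡ true → ∃ λ y → Links e x y
    incident⁻ {e} {x} h with x ≟ tail e | x ≟ head e | h
    ... | yes refl | _        | _ = head e , inj₁ (refl , refl)
    ... | no _     | yes refl | _ = tail e , inj₂ (refl , refl)

    adjacency : (Fin n → Bool) → Fin n → ℝ
    adjacency A x = weight (joins x A)

    cutWithin : (Fin n → Bool) → (Fin n → Bool) → ℝ
    cutWithin B X = weight (λ e → inside B e ∧ crosses X e)

    degH≤adjacency : ∀ H x → degH G w H x ≤ adjacency (V H) x
    degH≤adjacency H x = sumOver-mono 0≤w λ e h →
      let Ee , x∼e = ∧-true⁻ h
          _ , link = incident⁻ x∼e
          Vt , Vh = closed H e Ee
      in joins⁺ (V H) link (proj₂ (endpoints-in (V H) link (∧-true⁺ Vt Vh)))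


    adjacency-mono : ∀ {x} A B → (∀ y → x ≢ y → A y ≡ true → B y ≡ true) → adjacency A x ≤ adjacency B x
    adjacency-mono A B A⊆B = sumOver-mono 0≤w λ e h →
      let y , link , Ay = joins⁻ A h in joins⁺ B link (A⊆B y (Links-distinct link) Ay)

    adjacency-∪ : ∀ A B x → adjacency (A ∪ B) x ≤ adjacency A x + adjacency B x
    adjacency-∪ A B x = sumOver-subadditive 0≤w λ e h → let y , link , A∪B∋y = joins⁻ (A ∪ B) h in
      [ (λ Ay → ∨-trueˡ _ (joins⁺ A link Ay)) , (λ By → ∨-trueʳ (joins x A e) (joins⁺ B link By)) ]
        (∨-true⁻ A∪B∋y)

    linked-inside-crossing : ∀ {e x y} B X → Links e x y → B x ≡ true → B y ≡ true → X x ≢ X y →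
                             inside B e ∧ crosses X e ≡ true
    linked-inside-crossing B X link Bx By Xx≢Xy = ∧-true⁺ (inside⁺ B link Bx By) (crosses⁺ X link Xx≢Xy)

    adjacency⁅⁆≤cutWithin : ∀ {x y} B X → B x ≡ true → B y ≡ true → X x ≢ X y →
                            adjacency ⁅ y ⁆ x ≤ cutWithin B X
    adjacency⁅⁆≤cutWithin {y = y} B X Bx By Xx≢Xy = sumOver-mono 0≤w λ e h →
      linked-inside-crossing B X (joins⁅⁆⁻ y h) Bx By Xx≢Xy

    inside-mono : ∀ B B′ → B ⊆ B′ → inside B ⊆ inside B′
    inside-mono B B′ B⊆B′ e h = let Bt , Bh = ∧-true⁻ h in ∧-true⁺ (B⊆B′ _ Bt) (B⊆B′ _ Bh)

    linked-outside : ∀ {e x y} B → Links e x y → B x ≡ false ⊎ B y ≡ false → inside B e ≡ true → ⊥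
    linked-outside B link (inj₁ x∉B) h = membership-≢ B (proj₁ (endpoints-in B link h)) x∉B refl
    linked-outside B link (inj₂ y∉B) h = membership-≢ B (proj₂ (endpoints-in B link h)) y∉B refl

    cutWithin+adjacency⁅⁆≤cutWithin : ∀ {x y} B B′ X → B ⊆ B′ →
      B′ x ≡ true → B′ y ≡ true → B x ≡ false ⊎ B y ≡ false → X x ≢ X y →
      cutWithin B X + adjacency ⁅ y ⁆ x ≤ cutWithin B′ X
    cutWithin+adjacency⁅⁆≤cutWithin {y = y} B B′ X B⊆B′ B′x B′y x∉B⊎y∉B Xx≢Xy =
      sumOver-superadditive 0≤w
      (λ e h₁ h₂ → linked-outside B (joins⁅⁆⁻ y h₂) x∉B⊎y∉B (proj₁ (∧-true⁻ h₁)))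
      (λ e h → let in-B , crossing = ∧-true⁻ h in ∧-true⁺ (inside-mono B B′ B⊆B′ e in-B) crossing)
      (λ e h → linked-inside-crossing B′ X (joins⁅⁆⁻ y h) B′x B′y Xx≢Xy)

    cutWithin≤cutWeight : ∀ B X → cutWithin B X ≤ cutWeight G w X
    cutWithin≤cutWeight B X = sumOver-mono 0≤w {ψ = crosses X} λ e h → proj₂ (∧-true⁻ h)

    weight-empty : ∀ {φ} → (∀ e → φ e ≢ true) → weight φ ≤ 0ℝ
    weight-empty {φ} none =
      ≤-trans (sumOver-mono 0≤w {ψ = λ _ → false} λ e φe → ⊥-elim (none e φe)) (reflexive (ΣFin-0 {m}))

    -- Maximum-adjacency orderings

    module MaximumAdjacency (U : Fin n → Bool) (a : Fin n) where

      Remaining : (Fin n → Bool) → Fin n → Set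
      Remaining A x = U x ≡ true × A x ≡ false

      -- The Stoer–Wagner invariant of an ordering A of U ∪ {a} so far, ending in l.
      CutBound : (Fin n → Bool) → Fin n → Set
      CutBound A l = ∀ X u → Remaining A u → X u ≢ X l → adjacency A u ≤ cutWithin (A ∪ ⁅ u ⁆) X

      CutBound-start : CutBound ⁅ a ⁆ a
      CutBound-start X u _ Xu≢Xa = adjacency⁅⁆≤cutWithin (⁅ a ⁆ ∪ ⁅ u ⁆) X
        (∪-⊆ʳ ⁅ a ⁆ ⁅ u ⁆ u (⁅⁆-refl u)) (∪-⊆ˡ ⁅ a ⁆ ⁅ u ⁆ a (⁅⁆-refl a)) Xu≢Xa

      CutBound-step : ∀ {A l v} → Remaining A v → (∀ x → Remaining A x → adjacency A x ≤ adjacency A v) →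
                      CutBound A l → CutBound (A ∪ ⁅ v ⁆) v
      CutBound-step {A} {l} {v} (Uv , Av) v-max bound X u (Uu , u∉A∪v) Xu≢Xv = begin
        adjacency (A ∪ ⁅ v ⁆) u           ≤⟨ adjacency-∪ A ⁅ v ⁆ u ⟩
        adjacency A u + adjacency ⁅ v ⁆ u ≤⟨ by-side-of-v (X v Boolₚ.≟ X l) ⟩
        cutWithin B′ X                    ∎
        where
          B′ = A ∪ ⁅ v ⁆ ∪ ⁅ u ⁆
          Au : A u ≡ false
          Au = proj₁ (∨-false⁻ u∉A∪v)
          v≢u : v ≢ u
          v≢u = membership-≢ ⁅ v ⁆ (⁅⁆-refl v) (proj₂ (∨-false⁻ u∉A∪v))
          u∈B′ : B′ u ≡ true
          u∈B′ = ∪-⊆ʳ (A ∪ ⁅ v ⁆) ⁅ u ⁆ u (⁅⁆-refl u)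
          v∈B′ : B′ v ≡ true
          v∈B′ = ∪-⊆ˡ (A ∪ ⁅ v ⁆) ⁅ u ⁆ v (∪-⊆ʳ A ⁅ v ⁆ v (⁅⁆-refl v))

          -- If X keeps v with l, the invariant applies to u itself; otherwise it
          -- applies to v, whose adjacency to A dominates that of u.
          by-side-of-v : Dec (X v ≡ X l) → adjacency A u + adjacency ⁅ v ⁆ u ≤ cutWithin B′ X
          by-side-of-v (yes Xv≡Xl) = begin
            adjacency A u + adjacency ⁅ v ⁆ u
              ≤⟨ +-mono-≤ _ (bound X u (Uu , Au) (λ Xu≡Xl → Xu≢Xv (trans Xu≡Xl (sym Xv≡Xl)))) ⟩
            cutWithin (A ∪ ⁅ u ⁆) X + adjacency ⁅ v ⁆ u
              ≤⟨ cutWithin+adjacency⁅⁆≤cutWithin (A ∪ ⁅ u ⁆) B′ X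
                   (∪-least (λ z → ∪-⊆ˡ (A ∪ ⁅ v ⁆) ⁅ u ⁆ z ∘ ∪-⊆ˡ A ⁅ v ⁆ z)
                            (∪-⊆ʳ (A ∪ ⁅ v ⁆) ⁅ u ⁆))
                   u∈B′ v∈B′ (inj₂ (∨-false⁺ Av (⁅⁆-false v≢u))) Xu≢Xv ⟩
            cutWithin B′ X ∎
          by-side-of-v (no Xv≢Xl) = begin
            adjacency A u + adjacency ⁅ v ⁆ u
              ≤⟨ +-mono-≤ _ (≤-trans (v-max u (Uu , Au)) (bound X v (Uv , Av) Xv≢Xl)) ⟩
            cutWithin (A ∪ ⁅ v ⁆) X + adjacency ⁅ v ⁆ u
              ≤⟨ cutWithin+adjacency⁅⁆≤cutWithin (A ∪ ⁅ v ⁆) B′ X (∪-⊆ˡ (A ∪ ⁅ v ⁆) ⁅ u ⁆)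
                   u∈B′ v∈B′ (inj₁ u∉A∪v) Xu≢Xv ⟩
            cutWithin B′ X ∎

      record Prefix : Set where
        field
          A        : Fin n → Bool
          last     : Fin n
          a∈A      : A a ≡ true
          last∈A   : A last ≡ true
          cutBound : CutBound A last

      record PendantPair : Set where
        field
          s t      : Fin n
          t∈U      : U t ≡ true
          t≢a      : t ≢ a
          s≢t      : s ≢ t
          adjacency≤cut : ∀ X → X s ≡ true → X t ≡ false → adjacency U t ≤ cutWeight G w X

      initial : Prefix
      initial = record
        { A = ⁅ a ⁆ ; last = a ; a∈A = ⁅⁆-refl a ; last∈A = ⁅⁆-refl a ; cutBound = CutBound-start }

      Growth : Prefix → Set
      Growth p = Σ Prefix λ p′ → Sub.∣ members (Prefix.A p) ∣ ℕ.< Sub.∣ members (Prefix.A p′) ∣ ×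
                                 ∃ (Remaining (Prefix.A p′))

      module _ (p : Prefix) where
        open Prefix p

        mostAdjacent : ∀ {u} → Remaining A u →
                       Σ (Fin n) λ v → Remaining A v × (∀ x → Remaining A x → adjacency A x ≤ adjacency A v)
        mostAdjacent = Extremum.minimiser (Flip.totalOrder ≤-totalOrder) ∈-allFin
          (λ x → (U x Boolₚ.≟ true) ×-dec (A x Boolₚ.≟ false)) (adjacency A)

        finish : ∀ {t} → Remaining A t → U ⊆ A ∪ ⁅ t ⁆ → PendantPair
        finish {t} (Ut , At) U⊆A∪t = record
          { s        = last
          ; t        = t
          ; t∈U      = Ut
          ; t≢a      = membership-≢ A a∈A At ∘ sym
          ; s≢t      = membership-≢ A last∈A At
          ; adjacency≤cut = λ X Xs Xt → begin
              adjacency U t           ≤⟨ adjacency-mono U A U∖t⊆A ⟩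
              adjacency A t           ≤⟨ cutBound X t (Ut , At) (membership-≢ id Xs Xt ∘ sym) ⟩
              cutWithin (A ∪ ⁅ t ⁆) X ≤⟨ cutWithin≤cutWeight (A ∪ ⁅ t ⁆) X ⟩
              cutWeight G w X         ∎
          }
          where
            U∖t⊆A : ∀ y → t ≢ y → U y ≡ true → A y ≡ true
            U∖t⊆A y t≢y Uy =
              [ id , (λ y∈⁅t⁆ → ⊥-elim (t≢y (sym (⁅⁆-true⁻ y∈⁅t⁆)))) ] (∨-true⁻ (U⊆A∪t y Uy))

        advance : ∀ {u} → Remaining A u → PendantPair ⊎ Growth p
        advance Au with mostAdjacent Au
        ... | v , (Uv , Av) , v-max with any? (λ x → (U x Boolₚ.≟ true) ×-dec ((A ∪ ⁅ v ⁆) x Boolₚ.≟ false))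
        ...   | no none-left =
          inj₁ (finish (Uv , Av) λ x Ux → Boolₚ.¬-not (λ x∉A∪v → none-left (x , Ux , x∉A∪v)))
        ...   | yes left     = inj₂ (record
          { A        = A ∪ ⁅ v ⁆
          ; last     = v
          ; a∈A      = ∪-⊆ˡ A ⁅ v ⁆ a a∈A
          ; last∈A   = ∪-⊆ʳ A ⁅ v ⁆ v (⁅⁆-refl v)
          ; cutBound = CutBound-step (Uv , Av) v-max cutBound
          } , p⊂q⇒∣p∣<∣q∣ (members-⊂ A Av) , left)

      grow : ∀ k (p : Prefix) → n ℕ.≤ k ℕ.+ Sub.∣ members (Prefix.A p) ∣ →
             ∀ {u} → Remaining (Prefix.A p) u → PendantPair
      grow ℕ.zero    p enough (_ , Au) = ⊥-elim (NP.<⇒≱ (∣members∣<n (Prefix.A p) Au) enough)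
      grow (ℕ.suc k) p enough Au with advance p Au
      ... | inj₁ done                       = done
      ... | inj₂ (p′ , larger , _ , A′u′) =
        grow k p′ (NP.≤-trans enough (NP.≤-trans (NP.≤-reflexive (sym (NP.+-suc k _))) (NP.+-monoʳ-≤ k larger)))
             A′u′

      pendantPair : ∀ {u} → U u ≡ true → u ≢ a → PendantPair
      pendantPair Uu u≢a = grow n initial (NP.m≤m+n n _) (Uu , ⁅⁆-false u≢a)

    cutWeight-cong : ∀ {X Y} → (∀ x → X x ≡ Y x) → cutWeight G w X ≡ cutWeight G w Y
    cutWeight-cong X≗Y = ΣFin-cong λ e →
      cong₂ (λ p q → if p xor q then w e else 0ℝ) (X≗Y (tail e)) (X≗Y (head e))

    -- Cuts are enumerated as vectors: functions Fin n → Bool can only be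
    -- listed up to pointwise equality.
    minCut-exists : ∀ {s t} → s ≢ t → Σ ℝ (IsLocalConn G w s t)
    minCut-exists {s} {t} s≢t with IsMinOf-exists ∈-allBoolVecs
        (λ v → (lookup v s Boolₚ.≟ true) ×-dec (lookup v t Boolₚ.≟ false)) (cutWeight G w ∘ lookup)
        {tabulate ⁅ s ⁆}
        (trans (lookup∘tabulate _ s) (⁅⁆-refl s) , trans (lookup∘tabulate _ t) (⁅⁆-false (s≢t ∘ sym)))
    ... | cut , (v , separates , ≡cut) , cut-min =
      cut , (lookup v , separates , ≡cut) , λ X u (Xs , Xt) ≡u →
        cut-min (tabulate X) u (trans (lookup∘tabulate X s) Xs , trans (lookup∘tabulate X t) Xt)
                (trans (cutWeight-cong (lookup∘tabulate X)) ≡u)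

    wholeGraph : Subgraph G
    wholeGraph = sub (λ _ → true) (λ _ → true) (λ _ _ → refl , refl)

    Others : Subgraph G → Fin n → Fin n → Set
    Others H x₁ x = V H x ≡ true × x ≢ x₁

    others? : ∀ H x₁ → Decidable (Others H x₁)
    others? H x₁ x = (V H x Boolₚ.≟ true) ×-dec ¬? (x ≟ x₁)

    IsMinDegreeBesides : Subgraph G → Fin n → ℝ → Set
    IsMinDegreeBesides H x₁ = IsMinOf (Others H x₁) (λ x u → degH G w H x ≡ u)

    innerMin-exists : ∀ H {p q} → V H p ≡ true → V H q ≡ true → p ≢ q →
                      ∀ x₁ → Σ ℝ (IsMinDegreeBesides H x₁)
    innerMin-exists H {p} Vp Vq p≢q x₁ with x₁ ≟ p
    ... | yes refl = IsMinOf-exists ∈-allFin (others? H x₁) (degH G w H) (Vq , p≢q ∘ sym)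
    ... | no x₁≢p  = IsMinOf-exists ∈-allFin (others? H x₁) (degH G w H) (Vp , x₁≢p ∘ sym)

    δ₂-from-innerMins : ∀ H {p} → V H p ≡ true →
                        (∀ x₁ → Σ ℝ (IsMinDegreeBesides H x₁)) → Σ ℝ (IsDelta2 G w H)
    δ₂-from-innerMins H Vp innerMin
      with IsMaxOf-exists ∈-allFin (λ x → V H x Boolₚ.≟ true) (proj₁ ∘ innerMin) Vp
    ... | δ₂ , (x* , Vx* , refl) , δ₂-max =
      δ₂ , (x* , Vx* , proj₂ (innerMin x*)) , λ x₁ u Vx₁ u-min →
        subst (_≤ δ₂) (IsMinOf-unique (proj₂ (innerMin x₁)) u-min) (δ₂-max x₁ _ Vx₁ refl)

    δ₂-exists : ∀ H {p q} → V H p ≡ true → V H q ≡ true → p ≢ q → Σ ℝ (IsDelta2 G w H)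
    δ₂-exists H Vp Vq p≢q = δ₂-from-innerMins H Vp (innerMin-exists H Vp Vq p≢q)

    δ₂-nonneg : ∀ H {v} → IsDelta2 G w H v → 0ℝ ≤ v
    δ₂-nonneg H ((_ , _ , (x , _ , ≡v) , _) , _) = subst (0ℝ ≤_) ≡v (sumOver-nonneg 0≤w _)

    -- The three inequalities

    ≤-localConn : ∀ {s t c v} → IsLocalConn G w s t c →
                  (∀ X → X s ≡ true → X t ≡ false → v ≤ cutWeight G w X) → v ≤ c
    ≤-localConn ((X , (Xs , Xt) , ≡c) , _) v≤cuts = subst (_ ≤_) ≡c (v≤cuts X Xs Xt)

    D₂≤Λ : ∀ {Λv D₂v} → IsΛ G w Λv → IsD2 G w D₂v → D₂v ≤ Λv
    D₂≤Λ {Λv} {D₂v} (_ , Λ-max) ((H , _ , (x₁ , _ , (x₂ , (Vx₂ , x₂≢x₁) , _) , D₂-min) , _) , _) = begin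
      D₂v               ≤⟨ D₂-min t _ (t∈U , t≢a) refl ⟩
      degH G w H t      ≤⟨ degH≤adjacency H t ⟩
      adjacency (V H) t ≤⟨ ≤-localConn (proj₂ minCut) adjacency≤cut ⟩
      proj₁ minCut      ≤⟨ Λ-max (s , t) _ s≢t (proj₂ minCut) ⟩
      Λv                ∎
      where
        open MaximumAdjacency.PendantPair (MaximumAdjacency.pendantPair (V H) x₁ Vx₂ x₂≢x₁)
        minCut : Σ ℝ (IsLocalConn G w s t)
        minCut = minCut-exists s≢t

    δ≤δ₂ : ∀ H {x₀ y d v} → V H x₀ ≡ true → Others H x₀ y → IsDelta G w H d → IsDelta2 G w H v → d ≤ v
    δ≤δ₂ H {x₀} Vx₀ others-y δ-min (_ , δ₂-max) =
      ≤-trans (IsMinOf-antitone (λ _ → proj₁) δ-min (proj₂ inner)) (δ₂-max x₀ _ Vx₀ (proj₂ inner))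
      where
        inner : Σ ℝ (IsMinDegreeBesides H x₀)
        inner = IsMinOf-exists ∈-allFin (others? H x₀) (degH G w H) others-y

    degH-isolated : ∀ H {x} → ¬ ∃ (Others H x) → degH G w H x ≤ 0ℝ
    degH-isolated H {x} isolated = ≤-trans (degH≤adjacency H x) (weight-empty λ e h →
      let y , link , Vy = joins⁻ (V H) h in isolated (y , Vy , Links-distinct link ∘ sym))

    D≤D₂ : ∀ {p q : Fin n} → p ≢ q → ∀ {D₂v Dv} → IsD2 G w D₂v → IsD G w Dv → Dv ≤ D₂v
    D≤D₂ p≢q {D₂v} {Dv} (_ , D₂-max) ((H , _ , δ-min@((x₀ , Vx₀ , x₀-attains) , _)) , _)
      with any? (others? H x₀)
    ... | yes (y , others-y) = begin
      Dv        ≤⟨ δ≤δ₂ H Vx₀ others-y δ-min (proj₂ δ₂H) ⟩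
      proj₁ δ₂H ≤⟨ D₂-max H _ tt (proj₂ δ₂H) ⟩
      D₂v       ∎
      where
        δ₂H : Σ ℝ (IsDelta2 G w H)
        δ₂H = δ₂-exists H Vx₀ (proj₁ others-y) (proj₂ others-y ∘ sym)
    ... | no isolated = begin
      Dv            ≡⟨ x₀-attains ⟨
      degH G w H x₀ ≤⟨ degH-isolated H isolated ⟩
      0ℝ            ≤⟨ δ₂-nonneg wholeGraph (proj₂ δ₂G) ⟩
      proj₁ δ₂G     ≤⟨ D₂-max wholeGraph _ tt (proj₂ δ₂G) ⟩
      D₂v           ∎
      where
        δ₂G : Σ ℝ (IsDelta2 G w wholeGraph)
        δ₂G = δ₂-exists wholeGraph refl refl p≢q

  module _ {k} (G : Graph (ℕ.suc (ℕ.suc k))) (w : Weights G) (0≤w : NonNeg G w) where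
    open Network G w 0≤w

    Δₙ₋₁≤degG : ∀ {a b} (a≢b : a ≢ b) → degG G w a ≤ degG G w b →
                ∀ {Δv} → IsDeltaMaxNm1 G w Δv → Δv ≤ degG G w b
    Δₙ₋₁≤degG {a} {b} a≢b da≤db (_ , Δ-min) = Δ-min (exceptTwo a≢b) _ tt
      ((b , exceptTwo≢b a≢b , refl) , λ x u missed ≡u →
        subst (_≤ degG G w b) ≡u
          ([ (λ { refl → da≤db }) , (λ { refl → ≤-refl }) ] (exceptTwo-misses a≢b x missed)))

    degG≤δ₂ : ∀ {a b} → b ≢ a → (∀ x → x ≢ a → degG G w b ≤ degG G w x) →
              ∀ {v} → IsDelta2 G w wholeGraph v → degG G w b ≤ v
    degG≤δ₂ {a} {b} b≢a b-min (_ , δ₂-max) = δ₂-max a _ refl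
      ((b , (refl , b≢a) , refl) , λ x u (_ , x≢a) ≡u → subst (degG G w b ≤_) ≡u (b-min x x≢a))

    Δₙ₋₁≤D₂ : ∀ {D₂v Δv} → IsD2 G w D₂v → IsDeltaMaxNm1 G w Δv → Δv ≤ D₂v
    Δₙ₋₁≤D₂ {D₂v} {Δv} (_ , D₂-max) isΔ = via (twoSmallest (degG G w))
      where
        via : TwoSmallest (degG G w) → Δv ≤ D₂v
        via (a , b , b≢a , da≤db , b-min) = begin
          Δv         ≤⟨ Δₙ₋₁≤degG (b≢a ∘ sym) da≤db isΔ ⟩
          degG G w b ≤⟨ degG≤δ₂ b≢a b-min (proj₂ δ₂G) ⟩
          proj₁ δ₂G  ≤⟨ D₂-max wholeGraph _ tt (proj₂ δ₂G) ⟩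
          D₂v        ∎
          where
            δ₂G : Σ ℝ (IsDelta2 G w wholeGraph)
            δ₂G = δ₂-exists wholeGraph refl refl (b≢a ∘ sym)

open import Data.Nat using (_≤_)

proposition2p10 : (R : RealField) → let open RealField R using (ℝ) renaming (_≤_ to _≤ℝ_) in
    let open Weighted R in
    (n : ℕ) → 2 ≤ n → (G : Graph n) → (w : Weights G) → NonNeg G w →
    (Λv D2v Dv Δv : ℝ) →
    IsΛ G w Λv → IsD2 G w D2v → IsD G w Dv → IsDeltaMaxNm1 G w Δv →
    (D2v ≤ℝ Λv) × (Dv ≤ℝ D2v) × (Δv ≤ℝ D2v)
proposition2p10 R (ℕ.suc (ℕ.suc k)) _ G w 0≤w _ _ _ _ isΛ isD2 isD isΔ =
  D₂≤Λ isΛ isD2 , D≤D₂ {zero} {suc zero} (λ ()) isD2 isD , Δₙ₋₁≤D₂ G w 0≤w isD2 isΔ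
  where
    open Reals R
    open Network G w 0≤w
proposition2p10 R (ℕ.suc ℕ.zero) (ℕ.s≤s ()) _ _ _ _ _ _ _ _ _ _ _
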